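{- Any one-pass streaming algorithm that, given a stream consisting of a node $u$ followed by the edges of a rooted tree on $n$ nodes (whose root is denoted by a known symbol $r$), computes the depth of $u$ in the tree must use $\Omega(n\log n)$ bits of space.
   Context: Streaming model: the input arrives as a sequence of tokens that is read once in order (one pass), with no random access; the space of the algorithm is the maximum number of bits of memory it stores. The depth of a node in a rooted tree is its distance (number of edges) from the root. -}

module Defs where

open import Data.Nat using (ℕ; zero; suc; _+_; _*_; _^_; _≤_)
open import Data.Fin using (Fin)
open import Data.Product using (_×_; _,_; ∃)
open import Data.Sum using (_⊎_)
open import Data.List using (List; []; _∷_; length; foldl)
open import Data.List.Membership.Propositional using (_∈_)
open import Relation.Binary.PropositionalEquality using (_≡_)

-- Nodes of a tree on n = suc m nodes are Fin (suc m); the root r is Fin.zero.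
Node : ℕ → Set
Node m = Fin (suc m)

root : ∀ {m} → Node m
root = Fin.zero

Edge : ℕ → Set
Edge m = Node m × Node m

Adj : ∀ {m} → List (Edge m) → Node m → Node m → Set
Adj es a b = ((a , b) ∈ es) ⊎ ((b , a) ∈ es)

data Walk {m} (es : List (Edge m)) : Node m → Node m → ℕ → Set where
  here : ∀ {a} → Walk es a a 0
  step : ∀ {a b c k} → Adj es a b → Walk es b c k → Walk es a c (suc k)

IsTree : ∀ {m} → List (Edge m) → Set
IsTree {m} es = (length es ≡ m) × (∀ v → ∃ λ k → Walk es root v k)

IsDepth : ∀ {m} → List (Edge m) → Node m → ℕ → Set
IsDepth es u d = Walk es root u d × (∀ k → Walk es root u k → d ≤ k)

data Token (m : ℕ) : Set where
  node : Node m → Token m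
  edge : Edge m → Token m

stream : ∀ {m} → Node m → List (Edge m) → List (Token m)
stream u es = node u ∷ Data.List.map edge es

-- a deterministic one-pass streaming algorithm using s bits of memory:
-- its memory contents are one of the 2^s states.
record StreamAlg (m s : ℕ) : Set where
  field
    init : Fin (2 ^ s)
    δ    : Fin (2 ^ s) → Token m → Fin (2 ^ s)
    out  : Fin (2 ^ s) → ℕ

run : ∀ {m s} → StreamAlg m s → List (Token m) → ℕ
run A ts = StreamAlg.out A (foldl (StreamAlg.δ A) (StreamAlg.init A) ts)

ComputesDepth : ∀ {m s} → StreamAlg m s → Set
ComputesDepth {m} A =
  ∀ (u : Node m) (es : List (Edge m)) → IsTree es →
  ∀ d → IsDepth es u d → run A (stream u es) ≡ d

-- Fooling-set argument. Put k = 2^a with n ≈ 2^(a+2). For g : Fin k → Fin k build a tree: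
-- a spine root–c₀–c₁–…–c_{k-1}, leaves xᵢ hanging from c_{g i}, the query node u hanging
-- from x_j, and padding children of the root. The edges xᵢ–c_{g i} depend on g alone and are
-- streamed first, right after u; the remaining edges depend on j alone. The depth of u is
-- 3 + g j (a lower bound on walk lengths comes from a height function that changes by at most
-- one along every edge), so the memory after the first block determines every g j, i.e. g.
-- Hence k^k ≤ 2^s, that is s ≥ a 2^a, which is Ω(n log n).
module Submission where

open import Defs
open import Data.Nat using (ℕ; zero; suc; _+_; _*_; _^_; _≤_; _<_; s≤s; s≤s⁻¹; ⌊_/2⌋; ⌈_/2⌉; _∸_; NonZero; >-nonZero⁻¹)
open import Data.Nat.Properties
open import Data.Nat.Logarithm using (⌊log₂_⌋; ⌊log₂⌋-mono-≤; ⌊log₂⌊n/2⌋⌋≡⌊log₂n⌋∸1; ⌊log₂[2^n]⌋≡n)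
open import Data.Nat.Tactic.RingSolver using (solve-∀)
open import Data.Fin as F using (Fin; toℕ; _↑ˡ_; _↑ʳ_; splitAt; inject₁; combine; funToFin; finToFun)
open import Data.Fin.Properties using (splitAt-↑ˡ; splitAt-↑ʳ; join-splitAt; toℕ-inject₁; toℕ-injective; funToFin-finToFin; injective⇒≤)
open import Data.Product using (_×_; _,_; ∃; proj₁; proj₂; swap)
open import Data.Sum using (inj₁; inj₂; [_,_]; [_,_]′) renaming (swap to ⊎-swap)
open import Data.List using (List; _∷_; _++_; tabulate; length; foldl; map)
open import Data.List.Properties using (length-++; length-tabulate; map-++; foldl-++)
open import Data.List.Membership.Propositional.Properties using (∈-tabulate⁺; ∈-++⁺ˡ; ∈-++⁺ʳ)
open import Data.List.Relation.Unary.Any using (here; there)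
open import Data.List.Relation.Unary.All as All using (All; _∷_)
open import Data.List.Relation.Unary.All.Properties using (tabulate⁺; ++⁺)
open import Function using (_∘_; const)
open import Relation.Binary.PropositionalEquality hiding ([_])

2^-cancelˡ-≤ : ∀ {x y} → 2 ^ x ≤ 2 ^ y → x ≤ y
2^-cancelˡ-≤ {x} {y} 2^x≤2^y = begin
  x              ≡⟨ ⌊log₂[2^n]⌋≡n x ⟨
  ⌊log₂ 2 ^ x ⌋  ≤⟨ ⌊log₂⌋-mono-≤ 2^x≤2^y ⟩
  ⌊log₂ 2 ^ y ⌋  ≡⟨ ⌊log₂[2^n]⌋≡n y ⟩
  y              ∎
  where open ≤-Reasoning

n<2^[1+⌊log₂n⌋] : ∀ n → n < 2 ^ suc ⌊log₂ n ⌋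
n<2^[1+⌊log₂n⌋] n = ≰⇒> λ 2^[1+⌊log₂n⌋]≤n → 1+n≰n (begin
  suc ⌊log₂ n ⌋                 ≡⟨ ⌊log₂[2^n]⌋≡n (suc ⌊log₂ n ⌋) ⟨
  ⌊log₂ 2 ^ suc ⌊log₂ n ⌋ ⌋     ≤⟨ ⌊log₂⌋-mono-≤ 2^[1+⌊log₂n⌋]≤n ⟩
  ⌊log₂ n ⌋                     ∎)
  where open ≤-Reasoning

2*⌊n/2⌋≤n : ∀ n → 2 * ⌊ n /2⌋ ≤ n
2*⌊n/2⌋≤n n = begin
  2 * ⌊ n /2⌋            ≡⟨ cong (⌊ n /2⌋ +_) (+-identityʳ ⌊ n /2⌋) ⟩
  ⌊ n /2⌋ + ⌊ n /2⌋      ≤⟨ +-monoʳ-≤ ⌊ n /2⌋ (⌊n/2⌋≤⌈n/2⌉ n) ⟩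
  ⌊ n /2⌋ + ⌈ n /2⌉      ≡⟨ ⌊n/2⌋+⌈n/2⌉≡n n ⟩
  n                      ∎
  where open ≤-Reasoning

2^⌊log₂n⌋≤n : ∀ n .{{_ : NonZero n}} → 2 ^ ⌊log₂ n ⌋ ≤ n
2^⌊log₂n⌋≤n n = go ⌊log₂ n ⌋ n refl
  where
  go : ∀ L n .{{_ : NonZero n}} → ⌊log₂ n ⌋ ≡ L → 2 ^ L ≤ n
  go zero    n             _  = >-nonZero⁻¹ n
  go (suc L) (suc (suc n)) eq = begin
    2 * 2 ^ L                ≤⟨ *-monoʳ-≤ 2 (go L ⌊ suc (suc n) /2⌋ ⌊log₂⌊n/2⌋⌋≡L) ⟩
    2 * ⌊ suc (suc n) /2⌋    ≤⟨ 2*⌊n/2⌋≤n (suc (suc n)) ⟩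
    suc (suc n)              ∎
    where
    open ≤-Reasoning
    ⌊log₂⌊n/2⌋⌋≡L : ⌊log₂ ⌊ suc (suc n) /2⌋ ⌋ ≡ L
    ⌊log₂⌊n/2⌋⌋≡L = trans (⌊log₂⌊n/2⌋⌋≡⌊log₂n⌋∸1 (suc (suc n))) (cong (_∸ 1) eq)

funToFin-cong : ∀ {t k} {f g : Fin t → Fin k} → f ≗ g → funToFin f ≡ funToFin g
funToFin-cong {zero}  f≗g = refl
funToFin-cong {suc t} f≗g = cong₂ combine (f≗g F.zero) (funToFin-cong (f≗g ∘ F.suc))

^≤-if-pointwise-injective : ∀ {t k n} (F : (Fin t → Fin k) → Fin n) →
                            (∀ f g → F f ≡ F g → f ≗ g) → k ^ t ≤ n
^≤-if-pointwise-injective {t} {k} F F-inj = injective⇒≤ {f = F ∘ finToFun} λ {x} {y} Fx≡Fy → begin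
  x                             ≡⟨ funToFin-finToFin {t} {k} x ⟨
  funToFin (finToFun {k} {t} x) ≡⟨ funToFin-cong (F-inj _ _ Fx≡Fy) ⟩
  funToFin (finToFun {k} {t} y) ≡⟨ funToFin-finToFin {t} {k} y ⟩
  y                             ∎
  where open ≡-Reasoning

↑-elim : ∀ {a b} (P : Fin (a + b) → Set) →
         (∀ i → P (i ↑ˡ b)) → (∀ i → P (a ↑ʳ i)) → ∀ w → P w
↑-elim {a} {b} P left right w = subst P (join-splitAt a b w) ([_,_] {C = P ∘ F.join a b} left right (splitAt a w))

_≈₁_ : ℕ → ℕ → Set
x ≈₁ y = x ≤ suc y × y ≤ suc x

module _ {m : ℕ} {es : List (Edge m)} where

  _∷ʳ_ : ∀ {a b c k} → Walk es a b k → Adj es b c → Walk es a c (suc k)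
  here       ∷ʳ b~c = step b~c here
  step a~a′ w ∷ʳ b~c = step a~a′ (w ∷ʳ b~c)

  path-walk : ∀ {k} (v : Fin (suc k) → Node m) → (∀ i → Adj es (v (inject₁ i)) (v (F.suc i))) →
              ∀ i → Walk es (v F.zero) (v i) (toℕ i)
  path-walk         v adj F.zero    = here
  path-walk {suc k} v adj (F.suc i) = step (adj F.zero) (path-walk (v ∘ F.suc) (adj ∘ F.suc) i)

  Lipschitz : (Node m → ℕ) → Set
  Lipschitz h = All (λ ab → h (proj₁ ab) ≈₁ h (proj₂ ab)) es

  lipschitz-walk : ∀ {h a b n} → Lipschitz h → Walk es a b n → h b ≤ h a + n
  lipschitz-walk {h} {a} lip here = m≤m+n (h a) 0
  lipschitz-walk {h} {a} {n = suc n} lip (step {b = a′} a~a′ w) = begin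
    _              ≤⟨ lipschitz-walk lip w ⟩
    h a′ + n       ≤⟨ +-monoˡ-≤ n (≈₁-step a~a′) ⟩
    suc (h a + n)  ≡⟨ +-suc (h a) n ⟨
    h a + suc n    ∎
    where
    open ≤-Reasoning
    ≈₁-step : Adj es a a′ → h a′ ≤ suc (h a)
    ≈₁-step (inj₁ a,a′∈es) = proj₂ (All.lookup lip a,a′∈es)
    ≈₁-step (inj₂ a′,a∈es) = proj₁ (All.lookup lip a′,a∈es)

  lipschitz⇒IsDepth : ∀ {h u} → Lipschitz h → h root ≡ 0 → Walk es root u (h u) → IsDepth es u (h u)
  lipschitz⇒IsDepth {h} lip h[root]≡0 w =
    w , λ n w′ → subst (λ x → h _ ≤ x + n) h[root]≡0 (lipschitz-walk lip w′)

module _ {m s} (A : StreamAlg m s) where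
  open StreamAlg A

  memory : Node m → List (Edge m) → Fin (2 ^ s)
  memory u es = foldl δ (δ init (node u)) (map edge es)

  run-++ : ∀ u es fs → run A (stream u (es ++ fs)) ≡ out (foldl δ (memory u es) (map edge fs))
  run-++ u es fs = cong out (begin
    foldl δ (δ init (node u)) (map edge (es ++ fs))          ≡⟨ cong (foldl δ _) (map-++ edge es fs) ⟩
    foldl δ (δ init (node u)) (map edge es ++ map edge fs)   ≡⟨ foldl-++ δ _ (map edge es) (map edge fs) ⟩
    foldl δ (memory u es) (map edge fs)                      ∎)
    where open ≡-Reasoning

  run-++-cong : ∀ {u es es′} fs → memory u es ≡ memory u es′ →
                run A (stream u (es ++ fs)) ≡ run A (stream u (es′ ++ fs))
  run-++-cong {u} {es} {es′} fs same = begin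
    run A (stream u (es ++ fs))                   ≡⟨ run-++ u es fs ⟩
    out (foldl δ (memory u es) (map edge fs))     ≡⟨ cong (λ σ → out (foldl δ σ (map edge fs))) same ⟩
    out (foldl δ (memory u es′) (map edge fs))    ≡⟨ run-++ u es′ fs ⟨
    run A (stream u (es′ ++ fs))                  ∎
    where open ≡-Reasoning

module FoolingTree (k′ e : ℕ) where

  k : ℕ
  k = suc k′

  R U : Node (suc (k + k + e))
  R = F.zero
  U = F.suc F.zero

  C X : Fin k → Node (suc (k + k + e))
  C i = F.suc (F.suc (i ↑ˡ k ↑ˡ e))
  X i = F.suc (F.suc ((k ↑ʳ i) ↑ˡ e))

  E : Fin e → Node (suc (k + k + e))
  E i = F.suc (F.suc (k + k ↑ʳ i))

  leaf-edge : (Fin k → Fin k) → Fin k → Edge (suc (k + k + e))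
  leaf-edge g i = X i , C (g i)

  spine-edge : Fin k′ → Edge (suc (k + k + e))
  spine-edge i = C (inject₁ i) , C (F.suc i)

  padding-edge : Fin e → Edge (suc (k + k + e))
  padding-edge i = R , E i

  encoding : (Fin k → Fin k) → List (Edge (suc (k + k + e)))
  encoding g = tabulate (leaf-edge g)

  spine padding : List (Edge (suc (k + k + e)))
  spine   = tabulate spine-edge
  padding = tabulate padding-edge

  completion : Fin k → List (Edge (suc (k + k + e)))
  completion j = (R , C F.zero) ∷ spine ++ (U , X j) ∷ padding

  tree : (Fin k → Fin k) → Fin k → List (Edge (suc (k + k + e)))
  tree g j = encoding g ++ completion j

  module _ (g : Fin k → Fin k) (j : Fin k) where

    height : Node (suc (k + k + e)) → ℕ
    height F.zero                 = 0
    height (F.suc F.zero)         = 3 + toℕ (g j)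
    height (F.suc (F.suc w)) =
      [ [ (λ i → 1 + toℕ i) , (λ i → 2 + toℕ (g i)) ]′ ∘ splitAt k , const 1 ]′ (splitAt (k + k) w)

    height-C : ∀ i → height (C i) ≡ 1 + toℕ i
    height-C i rewrite splitAt-↑ˡ (k + k) (i ↑ˡ k) e | splitAt-↑ˡ k i k = refl

    height-X : ∀ i → height (X i) ≡ 2 + toℕ (g i)
    height-X i rewrite splitAt-↑ˡ (k + k) (k ↑ʳ i) e | splitAt-↑ʳ k k i = refl

    height-E : ∀ i → height (E i) ≡ 1
    height-E i rewrite splitAt-↑ʳ (k + k) e i = refl

    parent-child : ∀ a b {x} → height a ≡ x → height b ≡ suc x → height a ≈₁ height b
    parent-child a b {x} h[a]≡x h[b]≡1+x rewrite h[a]≡x | h[b]≡1+x = m≤n⇒m≤1+n (n≤1+n x) , ≤-refl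

    child-parent : ∀ a b {x} → height a ≡ suc x → height b ≡ x → height a ≈₁ height b
    child-parent a b h[a]≡1+x h[b]≡x = swap (parent-child b a h[b]≡x h[a]≡1+x)

    height-C-inject₁ : ∀ i → height (C (inject₁ i)) ≡ 1 + toℕ i
    height-C-inject₁ i = trans (height-C (inject₁ i)) (cong suc (toℕ-inject₁ i))

    height-lipschitz : Lipschitz {es = tree g j} height
    height-lipschitz =
      ++⁺ (tabulate⁺ {f = leaf-edge g} λ i → child-parent (X i) (C (g i)) (height-X i) (height-C (g i)))
          ( parent-child R (C F.zero) refl (height-C F.zero)
          ∷ ++⁺ (tabulate⁺ {f = spine-edge} λ i → parent-child (C (inject₁ i)) (C (F.suc i)) (height-C-inject₁ i) (height-C (F.suc i)))
                ( child-parent U (X j) refl (height-X j)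
                ∷ tabulate⁺ {f = padding-edge} λ i → parent-child R (E i) refl (height-E i)))

    X-C-adj : ∀ i → Adj (tree g j) (X i) (C (g i))
    X-C-adj i = inj₁ (∈-++⁺ˡ (∈-tabulate⁺ {f = leaf-edge g} i))

    R-C-adj : Adj (tree g j) R (C F.zero)
    R-C-adj = inj₁ (∈-++⁺ʳ (encoding g) (here refl))

    spine-adj : ∀ i → Adj (tree g j) (C (inject₁ i)) (C (F.suc i))
    spine-adj i = inj₁ (∈-++⁺ʳ (encoding g) (there (∈-++⁺ˡ (∈-tabulate⁺ i))))

    U-X-adj : Adj (tree g j) U (X j)
    U-X-adj = inj₁ (∈-++⁺ʳ (encoding g) (there (∈-++⁺ʳ spine (here refl))))

    R-E-adj : ∀ i → Adj (tree g j) R (E i)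
    R-E-adj i = inj₁ (∈-++⁺ʳ (encoding g) (there (∈-++⁺ʳ spine (there (∈-tabulate⁺ i)))))

    walk-C : ∀ i → Walk (tree g j) R (C i) (1 + toℕ i)
    walk-C i = step R-C-adj (path-walk C spine-adj i)

    walk-X : ∀ i → Walk (tree g j) R (X i) (2 + toℕ (g i))
    walk-X i = walk-C (g i) ∷ʳ ⊎-swap (X-C-adj i)

    walk-U : Walk (tree g j) R U (3 + toℕ (g j))
    walk-U = walk-X j ∷ʳ ⊎-swap U-X-adj

    Reachable : Node (suc (k + k + e)) → Set
    Reachable v = ∃ λ n → Walk (tree g j) R v n

    reachable : ∀ v → Reachable v
    reachable F.zero            = 0 , here
    reachable (F.suc F.zero)    = _ , walk-U
    reachable (F.suc (F.suc w)) = ↑-elim (Reachable ∘ F.suc ∘ F.suc)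
      (↑-elim (λ w → Reachable (F.suc (F.suc (w ↑ˡ e)))) (λ i → _ , walk-C i) (λ i → _ , walk-X i))
      (λ i → _ , step (R-E-adj i) here)
      w

    length-tree : length (tree g j) ≡ suc (k + k + e)
    length-tree = begin
      length (encoding g ++ completion j)                               ≡⟨ length-++ (encoding g) ⟩
      length (encoding g) + suc (length (spine ++ (U , X j) ∷ padding)) ≡⟨ cong (λ l → length (encoding g) + suc l) (length-++ spine) ⟩
      length (encoding g) + suc (length spine + suc (length padding))   ≡⟨ cong₂ (λ x y → x + suc y)
                                                                             (length-tabulate (leaf-edge g))
                                                                             (cong₂ (λ y z → y + suc z) (length-tabulate spine-edge) (length-tabulate padding-edge)) ⟩
      k + suc (k′ + suc e)                                              ≡⟨ rearrange k′ e ⟩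
      suc (k + k + e)                                                   ∎
      where
      open ≡-Reasoning
      rearrange : ∀ k′ e → suc k′ + suc (k′ + suc e) ≡ suc (suc k′ + suc k′ + e)
      rearrange = solve-∀

    tree-IsTree : IsTree (tree g j)
    tree-IsTree = length-tree , reachable

    U-IsDepth : IsDepth (tree g j) U (3 + toℕ (g j))
    U-IsDepth = lipschitz⇒IsDepth height-lipschitz refl walk-U

  module _ {s} (A : StreamAlg (suc (k + k + e)) s) (computes : ComputesDepth A) where

    run-tree : ∀ g j → run A (stream U (tree g j)) ≡ 3 + toℕ (g j)
    run-tree g j = computes U (tree g j) (tree-IsTree g j) _ (U-IsDepth g j)

    memory-determines-encoding : ∀ g g′ → memory A U (encoding g) ≡ memory A U (encoding g′) → g ≗ g′
    memory-determines-encoding g g′ same j = toℕ-injective (+-cancelˡ-≡ 3 _ _ (begin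
      3 + toℕ (g j)                   ≡⟨ run-tree g j ⟨
      run A (stream U (tree g j))     ≡⟨ run-++-cong A {U} {encoding g} {encoding g′} (completion j) same ⟩
      run A (stream U (tree g′ j))    ≡⟨ run-tree g′ j ⟩
      3 + toℕ (g′ j)                  ∎))
      where open ≡-Reasoning

    k^k≤2^s : k ^ k ≤ 2 ^ s
    k^k≤2^s = ^≤-if-pointwise-injective (memory A U ∘ encoding) memory-determines-encoding

ComputesDepth⇒k^k≤2^s : ∀ {m s} k → k + k < m → (A : StreamAlg m s) → ComputesDepth A → k ^ k ≤ 2 ^ s
ComputesDepth⇒k^k≤2^s {s = s} zero     _     _ _ = m^n>0 2 s
ComputesDepth⇒k^k≤2^s         (suc k′) 2k<m A computes with e , refl ← m≤n⇒∃[o]m+o≡n 2k<m =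
  FoolingTree.k^k≤2^s k′ e A computes

a*2^a≤s : ∀ {m s} a → 2 ^ (2 + a) ≤ suc m → (A : StreamAlg m s) → ComputesDepth A → a * 2 ^ a ≤ s
a*2^a≤s {m} {s} a 2^[2+a]≤1+m A computes = 2^-cancelˡ-≤ (begin
  2 ^ (a * 2 ^ a)     ≡⟨ ^-*-assoc 2 a (2 ^ a) ⟨
  (2 ^ a) ^ (2 ^ a)   ≤⟨ ComputesDepth⇒k^k≤2^s (2 ^ a) 2^a+2^a<m A computes ⟩
  2 ^ s               ∎)
  where
  open ≤-Reasoning
  quadruple : ∀ k → (k + k) + (k + k) ≡ 2 * (2 * k)
  quadruple = solve-∀
  2^a+2^a<m : 2 ^ a + 2 ^ a < m
  2^a+2^a<m = s≤s⁻¹ (begin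
    2 + (2 ^ a + 2 ^ a)               ≤⟨ +-monoˡ-≤ (2 ^ a + 2 ^ a) (+-mono-≤ (m^n>0 2 a) (m^n>0 2 a)) ⟩
    (2 ^ a + 2 ^ a) + (2 ^ a + 2 ^ a) ≡⟨ quadruple (2 ^ a) ⟩
    2 ^ (2 + a)                       ≤⟨ 2^[2+a]≤1+m ⟩
    suc m                             ∎)

n[2+a]≤16[a*2^a] : ∀ {n} a → 2 ≤ a → n < 2 ^ (3 + a) → n * (2 + a) ≤ 16 * (a * 2 ^ a)
n[2+a]≤16[a*2^a] {n} a 2≤a n<2^[3+a] = begin
  n * (2 + a)             ≤⟨ *-mono-≤ (<⇒≤ n<2^[3+a]) (+-monoˡ-≤ a 2≤a) ⟩
  2 ^ (3 + a) * (a + a)   ≡⟨ regroup (2 ^ a) a ⟩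
  16 * (a * 2 ^ a)        ∎
  where
  open ≤-Reasoning
  regroup : ∀ x a → 2 * (2 * (2 * x)) * (a + a) ≡ 16 * (a * x)
  regroup = solve-∀

n*L≤16*s : ∀ {m s} L → 4 ≤ L → 2 ^ L ≤ suc m → suc m < 2 ^ suc L →
           (A : StreamAlg m s) → ComputesDepth A → suc m * L ≤ 16 * s
n*L≤16*s {m} {s} (suc (suc a)) (s≤s (s≤s 2≤a)) 2^L≤1+m 1+m<2^[1+L] A computes = begin
  suc m * (2 + a)      ≤⟨ n[2+a]≤16[a*2^a] a 2≤a 1+m<2^[1+L] ⟩
  16 * (a * 2 ^ a)     ≤⟨ *-monoʳ-≤ 16 (a*2^a≤s a 2^L≤1+m A computes) ⟩
  16 * s               ∎
  where open ≤-Reasoning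

claim2 : ∃ λ (c : ℕ) → ∃ λ (n₀ : ℕ) →
           ∀ (m s : ℕ) → n₀ ≤ suc m → (A : StreamAlg m s) → ComputesDepth A →
           suc m * ⌊log₂ suc m ⌋ ≤ c * s
claim2 = 16 , 16 , λ m s 16≤1+m A computes →
  n*L≤16*s ⌊log₂ suc m ⌋ (4≤⌊log₂n⌋ 16≤1+m) (2^⌊log₂n⌋≤n (suc m)) (n<2^[1+⌊log₂n⌋] (suc m)) A computes
  where
  4≤⌊log₂n⌋ : ∀ {n} → 2 ^ 4 ≤ n → 4 ≤ ⌊log₂ n ⌋
  4≤⌊log₂n⌋ {n} 16≤n = subst (_≤ ⌊log₂ n ⌋) (⌊log₂[2^n]⌋≡n 4) (⌊log₂⌋-mono-≤ 16≤n)
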